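{- Let $V\subseteq\mathbb{P}$ be a finite node set with at least two elements, smallest element $v$ and largest element $w$. The twisting map $\mathrm{tw}$ is a bijection from the set of valid digraphs on $V$ containing the forward arrow $(v,w)$ to the set of valid digraphs on $V-\{v\}$.
   Context: For a finite node set $V\subseteq\mathbb{P}$, an arrow $(x,y)$ with $x\ne y$ in $V$ has tail $x$, head $y$; it is forward if $x<y$, backward if $x>y$; its interval is $\{\min(x,y),\ldots,\max(x,y)\}$. Two arrows cross if their intervals $[a_1,a_2]$, $[b_1,b_2]$ satisfy $a_1<b_1<a_2<b_2$ or $b_1<a_1<b_2<a_2$; an arrow nests another if its interval contains the other's; two arrows nest if one nests the other. A valid digraph on $V$ is a set $A$ of arrows on $V$ such that: (1) no two arrows cross; (2) any two forward arrows nest; (3) no backward arrow nests a forward arrow; (4) no head of an arrow is the tail of another arrow. For $W\subseteq V$, $A_W$ denotes the arrows of $A$ with both endpoints in $W$. For a digraph $A$ on $V$ containing $(v,w)$ with $v=\min V$, $w=\max V$, the twisted digraph $\mathrm{tw}(A)$ is the digraph on $V-\{v\}$ with arrow set $A_{V-\{v\}}\cup\{(w,z):(v,z)\in A\}$. -}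

module Defs where

open import Level using (0ℓ)
open import Data.Nat using (ℕ; _≤_; _<_; _⊓_; _⊔_)
open import Data.Product using (_×_; _,_; Σ)
open import Data.Sum using (_⊎_)
open import Data.Empty using (⊥)
open import Relation.Nullary using (¬_)
open import Relation.Unary using (Pred; _≐_)
open import Relation.Binary.PropositionalEquality using (_≡_; _≢_)

-- A node set is a subset of ℕ (membership predicate); the actual node sets
-- in the theorem are finite lists of positive integers.
NodeSet : Set₁
NodeSet = Pred ℕ 0ℓ

_minus_ : NodeSet → ℕ → NodeSet
(V minus v) x = V x × x ≢ v

Arrow : Set
Arrow = ℕ × ℕ

tail head : Arrow → ℕ
tail (x , y) = x
head (x , y) = y

Forward Backward : Arrow → Set
Forward  (x , y) = x < y
Backward (x , y) = y < x

lo hi : Arrow → ℕ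
lo (x , y) = x ⊓ y
hi (x , y) = x ⊔ y

Cross : Arrow → Arrow → Set
Cross a b =
  (lo a < lo b × lo b < hi a × hi a < hi b) ⊎
  (lo b < lo a × lo a < hi b × hi b < hi a)

Nests : Arrow → Arrow → Set
Nests a b = lo a ≤ lo b × hi b ≤ hi a

NestEachOther : Arrow → Arrow → Set
NestEachOther a b = Nests a b ⊎ Nests b a

Digraph : Set₁
Digraph = Pred Arrow 0ℓ

OnNodes : NodeSet → Digraph → Set
OnNodes V A = ∀ x y → A (x , y) → V x × V y × x ≢ y

record Valid (V : NodeSet) (A : Digraph) : Set where
  field
    onV       : OnNodes V A
    noCross   : ∀ a b → A a → A b → ¬ Cross a b
    fwdNest   : ∀ a b → A a → A b → Forward a → Forward b → NestEachOther a b
    bwdNoNest : ∀ a b → A a → A b → Backward a → Forward b → ¬ Nests a b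
    headTail  : ∀ a b → A a → A b → head a ≢ tail b

restrict : Digraph → NodeSet → Digraph
restrict A W (x , y) = A (x , y) × W x × W y

-- twisted digraph on V - {v}, where v = min V, w = max V:
-- A_{V-{v}} ∪ {(w,z) : (v,z) ∈ A}; since arrows have distinct endpoints,
-- the pair (w,w) arising from (v,w) ∈ A is not an arrow and is excluded.
tw : NodeSet → ℕ → ℕ → Digraph → Digraph
tw V v w A (x , y) = restrict A (V minus v) (x , y) ⊎ (x ≡ w × y ≢ w × A (v , y))

-- Since v = min V and w = max V, the arrow (v , w) nests every arrow, and in a
-- valid digraph containing it v is never a head and w never a tail.  Hence every
-- other arrow at v is a forward arrow (v , z), and twisting just moves its tail
-- to the other end of the node set, turning it into the backward arrow (w , z);
-- the inverse moves tails at w back to v and restores (v , w).  Because no node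
-- lies outside [v , w], a crossing or forbidden nesting involving (w , z) on one
-- side always yields one involving (v , z) on the other.
module Submission where

open import Defs
open import Data.Nat using (ℕ; _≤_; _<_; _≟_; _≤?_)
open import Data.Nat.Properties
open import Data.Product using (_×_; _,_; Σ; proj₁; proj₂)
open import Data.Sum using (_⊎_; inj₁; inj₂) renaming (swap to ⊎-swap)
open import Data.Empty using (⊥; ⊥-elim)
open import Data.List using (List)
open import Data.List.Relation.Unary.All using (All)
open import Data.List.Membership.Propositional using (_∈_)
open import Relation.Unary using (_≐_; _⊆_)
open import Relation.Nullary using (¬_; yes; no)
open import Relation.Binary.PropositionalEquality

lo-forward : ∀ {x y} → x < y → lo (x , y) ≡ x
lo-forward x<y = m≤n⇒m⊓n≡m (<⇒≤ x<y)

hi-forward : ∀ {x y} → x < y → hi (x , y) ≡ y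
hi-forward x<y = m≤n⇒m⊔n≡n (<⇒≤ x<y)

lo-backward : ∀ {x y} → y < x → lo (x , y) ≡ y
lo-backward y<x = m≥n⇒m⊓n≡n (<⇒≤ y<x)

hi-backward : ∀ {x y} → y < x → hi (x , y) ≡ x
hi-backward y<x = m≥n⇒m⊔n≡m (<⇒≤ y<x)

forward⇒lo<hi : ∀ a → Forward a → lo a < hi a
forward⇒lo<hi (x , y) x<y = ≤-<-trans (m⊓n≤m x y) (<-≤-trans x<y (m≤n⊔m x y))

cross-sym : ∀ a b → Cross a b → Cross b a
cross-sym a b = ⊎-swap

same-hi⇒¬cross : ∀ a b → hi a ≡ hi b → ¬ Cross a b
same-hi⇒¬cross a b e (inj₁ (_ , _ , h)) = <-irrefl e h
same-hi⇒¬cross a b e (inj₂ (_ , _ , h)) = <-irrefl (sym e) h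

same-lo⇒¬cross : ∀ a b → lo a ≡ lo b → ¬ Cross a b
same-lo⇒¬cross a b e (inj₁ (h , _)) = <-irrefl e h
same-lo⇒¬cross a b e (inj₂ (h , _)) = <-irrefl (sym e) h

module _ {V : NodeSet} {A : Digraph} (valid : Valid V A) where
  open Valid valid

  no-path₂ : ∀ {x y z} → A (x , y) → A (y , z) → ⊥
  no-path₂ {x} {y} {z} a b = headTail (x , y) (y , z) a b refl

  tail∈ : ∀ {x y} → A (x , y) → V x
  tail∈ {x} {y} a = proj₁ (onV x y a)

  head∈ : ∀ {x y} → A (x , y) → V y
  head∈ {x} {y} a = proj₁ (proj₂ (onV x y a))

  tail≢head : ∀ {x y} → A (x , y) → x ≢ y
  tail≢head {x} {y} a = proj₂ (proj₂ (onV x y a))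

module Twisting (V : NodeSet) {v w : ℕ} (Vv : V v) (Vw : V w)
                (bounded : ∀ x → V x → v ≤ x × x ≤ w) (v<w : v < w) where

  V⁻ : NodeSet
  V⁻ = V minus v

  min≤ : ∀ {x} → V x → v ≤ x
  min≤ {x} Vx = proj₁ (bounded x Vx)

  ≤max : ∀ {x} → V x → x ≤ w
  ≤max {x} Vx = proj₂ (bounded x Vx)

  min< : ∀ {x} → V x → x ≢ v → v < x
  min< Vx x≢v = ≤∧≢⇒< (min≤ Vx) (λ e → x≢v (sym e))

  <max : ∀ {x} → V x → x ≢ w → x < w
  <max Vx x≢w = ≤∧≢⇒< (≤max Vx) x≢w

  min≢max : v ≢ w
  min≢max e = <-irrefl e v<w

  min≤lo : ∀ {p q} → V p → V q → v ≤ lo (p , q)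
  min≤lo Vp Vq = ⊓-glb (min≤ Vp) (min≤ Vq)

  min<lo : ∀ {p q} → V⁻ p → V⁻ q → v < lo (p , q)
  min<lo (Vp , p≢v) (Vq , q≢v) = ⊓-glb (min< Vp p≢v) (min< Vq q≢v)

  hi≤max : ∀ {p q} → V p → V q → hi (p , q) ≤ w
  hi≤max Vp Vq = ⊔-lub (≤max Vp) (≤max Vq)

  hi<max : ∀ {p q} → V p → V q → p ≢ w → q ≢ w → hi (p , q) < w
  hi<max Vp Vq p≢w q≢w = ⊔-lub (<max Vp p≢w) (<max Vq q≢w)

  min-max-nests : ∀ {p q} → V p → V q → Nests (v , w) (p , q)
  min-max-nests Vp Vq = ≤-trans (m⊓n≤m v w) (min≤lo Vp Vq) , ≤-trans (hi≤max Vp Vq) (m≤n⊔m v w)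

  ¬lo≤min : ∀ {p q z} → V⁻ p → V⁻ q → ¬ lo (p , q) ≤ lo (v , z)
  ¬lo≤min Vp Vq l = <⇒≱ (min<lo Vp Vq) (≤-trans l (m⊓n≤m v _))

  module Twist (A : Digraph) (valid : Valid V A) where
    open Valid valid

    T : Digraph
    T = tw V v w A

    inner-head : ∀ {z} → A (v , z) → z ≢ w → V z × v < z × z < w
    inner-head {z} a z≢w = head∈ valid a , min< (head∈ valid a) (λ e → tail≢head valid a (sym e))
                         , <max (head∈ valid a) z≢w

    twisted-not-forward : ∀ {z} → A (v , z) → ¬ (w < z)
    twisted-not-forward a w<z = <⇒≱ w<z (≤max (head∈ valid a))

    -- A crossing of (w , z) with an arrow away from v can only cross at z, and
    -- then the same arrow crosses (v , z).
    twisted¬cross-old : ∀ {z p q} → A (v , z) → z ≢ w → A (p , q) → V⁻ p → V⁻ q →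
                        ¬ Cross (w , z) (p , q)
    twisted¬cross-old {z} {p} {q} avz z≢w apq Vp Vq (inj₁ (_ , _ , w<hi)) =
      <⇒≱ (subst (_< hi (p , q)) (hi-backward (proj₂ (proj₂ (inner-head avz z≢w)))) w<hi)
          (hi≤max (tail∈ valid apq) (head∈ valid apq))
    twisted¬cross-old {z} {p} {q} avz z≢w apq Vp Vq (inj₂ (lo<z , z<hi , _))
      with inner-head avz z≢w
    ... | _ , v<z , z<w = noCross (v , z) (p , q) avz apq
          (inj₁ ( subst (_< lo (p , q)) (sym (lo-forward v<z)) (min<lo Vp Vq)
                , subst (lo (p , q) <_) z-end lo<z
                , subst (_< hi (p , q)) z-end z<hi))
      where
        z-end : lo (w , z) ≡ hi (v , z)
        z-end = trans (lo-backward z<w) (sym (hi-forward v<z))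

    tw-onV : OnNodes V⁻ T
    tw-onV x y (inj₁ (a , Vx , Vy)) = Vx , Vy , tail≢head valid a
    tw-onV x y (inj₂ (refl , y≢w , a)) =
      (Vw , λ e → min≢max (sym e)) , (head∈ valid a , λ e → tail≢head valid a (sym e))
      , λ e → y≢w (sym e)

    tw-noCross : ∀ a b → T a → T b → ¬ Cross a b
    tw-noCross _ _ (inj₁ (a , _)) (inj₁ (b , _)) = noCross _ _ a b
    tw-noCross _ _ (inj₂ (refl , y≢w , a)) (inj₁ (b , Vp , Vq)) = twisted¬cross-old a y≢w b Vp Vq
    tw-noCross x y (inj₁ (a , Vx , Vy)) (inj₂ (refl , q≢w , b)) c =
      twisted¬cross-old b q≢w a Vx Vy (cross-sym x y c)
    tw-noCross (_ , y) (_ , q) (inj₂ (refl , _ , a)) (inj₂ (refl , _ , b)) =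
      same-hi⇒¬cross (w , y) (w , q)
        (trans (m≥n⇒m⊔n≡m (≤max (head∈ valid a))) (sym (m≥n⇒m⊔n≡m (≤max (head∈ valid b)))))

    tw-fwdNest : ∀ a b → T a → T b → Forward a → Forward b → NestEachOther a b
    tw-fwdNest _ _ (inj₁ (a , _)) (inj₁ (b , _)) fa fb = fwdNest _ _ a b fa fb
    tw-fwdNest _ _ (inj₂ (refl , _ , a)) _ fa _ = ⊥-elim (twisted-not-forward a fa)
    tw-fwdNest _ _ (inj₁ _) (inj₂ (refl , _ , b)) _ fb = ⊥-elim (twisted-not-forward b fb)

    -- If (w , y) nested a forward (p , q), then (v , y) and (p , q) could not nest.
    tw-bwdNoNest : ∀ a b → T a → T b → Backward a → Forward b → ¬ Nests a b
    tw-bwdNoNest _ _ _ (inj₂ (refl , _ , b)) _ fb = ⊥-elim (twisted-not-forward b fb)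
    tw-bwdNoNest _ _ (inj₁ (a , _)) (inj₁ (b , _)) ba fb = bwdNoNest _ _ a b ba fb
    tw-bwdNoNest (_ , y) (p , q) (inj₂ (refl , y≢w , a)) (inj₁ (b , Vp , Vq)) _ fb (lo≤ , _)
      with inner-head a y≢w
    ... | _ , v<y , y<w with fwdNest (v , y) (p , q) a b v<y fb
    ... | inj₁ (_ , hi≤y) = <-irrefl refl (<-≤-trans (forward⇒lo<hi (p , q) fb)
            (≤-trans hi≤y (≤-trans (≤-reflexive (trans (hi-forward v<y) (sym (lo-backward y<w)))) lo≤)))
    ... | inj₂ (lo≤v , _) = ¬lo≤min Vp Vq lo≤v

    -- An old arrow (x , w) and a twisted (w , q) would make (x , w), (v , q) two
    -- forward arrows that do not nest.
    tw-headTail : ∀ a b → T a → T b → head a ≢ tail b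
    tw-headTail _ _ (inj₁ (a , _)) (inj₁ (b , _)) eq = headTail _ _ a b eq
    tw-headTail _ _ (inj₂ (refl , _ , a)) (inj₁ (b , _)) refl = no-path₂ valid a b
    tw-headTail _ _ (inj₂ (refl , y≢w , _)) (inj₂ (refl , _ , _)) eq = y≢w eq
    tw-headTail (x , _) (_ , q) (inj₁ (a , Vx , _)) (inj₂ (refl , q≢w , b)) refl
      with inner-head b q≢w
    ... | _ , v<q , q<w with fwdNest (x , w) (v , q) a b (<max (tail∈ valid a) (tail≢head valid a)) v<q
    ... | inj₁ (lo≤v , _) = ¬lo≤min Vx (Vw , λ e → min≢max (sym e)) lo≤v
    ... | inj₂ (_ , w≤hi) = <⇒≱ (subst (_< w) (sym (hi-forward v<q)) q<w) (≤-trans (m≤n⊔m x w) w≤hi)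

    tw-valid : Valid V⁻ T
    tw-valid = record { onV = tw-onV ; noCross = tw-noCross ; fwdNest = tw-fwdNest
                      ; bwdNoNest = tw-bwdNoNest ; headTail = tw-headTail }

  tw-reflects-⊆ : ∀ {A B} → Valid V A → A (v , w) → Valid V B → B (v , w) →
                  tw V v w A ⊆ tw V v w B → A ⊆ B
  tw-reflects-⊆ {A} {B} VA vw∈A VB vw∈B tw⊆ {x , y} a with x ≟ v
  ... | yes refl = from-min
    where
      from-min : B (v , y)
      from-min with y ≟ w
      ... | yes refl = vw∈B
      ... | no y≢w with tw⊆ (inj₂ (refl , y≢w , a))
      ...   | inj₁ (b , _) = ⊥-elim (no-path₂ VB vw∈B b)
      ...   | inj₂ (_ , _ , b) = b
  ... | no x≢v = away-from-min
    where
      away-from-min : B (x , y)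
      away-from-min with y ≟ v
      ... | yes refl = ⊥-elim (no-path₂ VA a vw∈A)
      ... | no y≢v with tw⊆ (inj₁ (a , (tail∈ VA a , x≢v) , (head∈ VA a , y≢v)))
      ...   | inj₁ (b , _) = b
      ...   | inj₂ (refl , _ , _) = ⊥-elim (no-path₂ VA vw∈A a)

  module Untwist (B : Digraph) (valid : Valid V⁻ B) where
    open Valid valid

    untwist : Digraph
    untwist (x , y) = (x ≡ v × y ≡ w) ⊎ (x ≡ v × B (w , y)) ⊎ (B (x , y) × x ≢ w)

    from-max : ∀ {z} → B (w , z) → V⁻ z × v < z × z < w
    from-max {z} b with head∈ valid b
    ... | Vz , z≢v = (Vz , z≢v) , min< Vz z≢v , <max Vz (λ e → tail≢head valid b (sym e))

    -- An arrow not at w ends before w, so z strictly inside it means it crosses (w , z).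
    z-inside : ∀ {z p q} → B (w , z) → B (p , q) → p ≢ w → lo (p , q) < z → z < hi (p , q) → ⊥
    z-inside {z} {p} {q} bwz bpq p≢w lo<z z<hi with q ≟ w
    ... | yes refl = no-path₂ valid bpq bwz
    ... | no q≢w with tail∈ valid bpq | head∈ valid bpq | from-max bwz
    ...   | Vp , _ | Vq , _ | _ , _ , z<w = noCross (w , z) (p , q) bwz bpq
              (inj₂ ( subst (lo (p , q) <_) (sym (lo-backward z<w)) lo<z
                    , subst (_< hi (p , q)) (sym (lo-backward z<w)) z<hi
                    , subst (hi (p , q) <_) (sym (hi-backward z<w)) (hi<max Vp Vq p≢w q≢w)))

    untwisted¬cross-old : ∀ {z p q} → B (w , z) → B (p , q) → p ≢ w → ¬ Cross (v , z) (p , q)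
    untwisted¬cross-old {z} {p} {q} bwz bpq p≢w c with from-max bwz
    ... | _ , v<z , _ with c
    ... | inj₁ (_ , lo<z , z<hi) =
      z-inside bwz bpq p≢w (subst (lo (p , q) <_) (hi-forward v<z) lo<z)
                           (subst (_< hi (p , q)) (hi-forward v<z) z<hi)
    ... | inj₂ (lo<v , _) =
      ¬lo≤min (tail∈ valid bpq) (head∈ valid bpq) (<⇒≤ lo<v)

    min-max¬cross-old : ∀ {p q} → B (p , q) → ¬ Cross (v , w) (p , q)
    min-max¬cross-old {p} {q} b (inj₁ (_ , _ , w<hi)) =
      <⇒≱ (subst (_< hi (p , q)) (hi-forward v<w) w<hi)
          (hi≤max (proj₁ (tail∈ valid b)) (proj₁ (head∈ valid b)))
    min-max¬cross-old {p} {q} b (inj₂ (lo<v , _)) =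
      ¬lo≤min (tail∈ valid b) (head∈ valid b) (<⇒≤ lo<v)

    -- (v , z) nests a forward (p , q): the left end because lo (p , q) ≤ z would
    -- let (w , z) nest (p , q), the right end because of z-inside.
    untwisted-nests-old : ∀ {z p q} → B (w , z) → B (p , q) → p ≢ w → p < q → Nests (v , z) (p , q)
    untwisted-nests-old {z} {p} {q} bwz bpq p≢w p<q with from-max bwz
    ... | _ , v<z , z<w =
      ≤-trans (m⊓n≤m v z) (min≤lo (proj₁ (tail∈ valid bpq)) (proj₁ (head∈ valid bpq))) , hi≤
      where
        lo<z : lo (p , q) < z
        lo<z = ≰⇒> λ z≤lo → bwdNoNest (w , z) (p , q) bwz bpq z<w p<q
                 ( subst (_≤ lo (p , q)) (sym (lo-backward z<w)) z≤lo
                 , ≤-trans (hi≤max (proj₁ (tail∈ valid bpq)) (proj₁ (head∈ valid bpq))) (m≤m⊔n w z))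
        hi≤ : hi (p , q) ≤ hi (v , z)
        hi≤ with hi (p , q) ≤? z
        ... | yes hi≤z = ≤-trans hi≤z (m≤n⊔m v z)
        ... | no hi≰z = ⊥-elim (z-inside bwz bpq p≢w lo<z (≰⇒> hi≰z))

    untwist-onV : OnNodes V untwist
    untwist-onV _ _ (inj₁ (refl , refl)) = Vv , Vw , min≢max
    untwist-onV _ _ (inj₂ (inj₁ (refl , b))) with from-max b
    ... | (Vz , z≢v) , _ = Vv , Vz , λ e → z≢v (sym e)
    untwist-onV _ _ (inj₂ (inj₂ (b , _))) =
      proj₁ (tail∈ valid b) , proj₁ (head∈ valid b) , tail≢head valid b

    untwist-noCross : ∀ a b → untwist a → untwist b → ¬ Cross a b
    untwist-noCross _ _ (inj₁ (refl , refl)) (inj₁ (refl , refl)) = same-hi⇒¬cross _ _ refl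
    untwist-noCross _ _ (inj₁ (refl , refl)) (inj₂ (inj₁ (refl , b))) =
      same-lo⇒¬cross _ _ (trans (lo-forward v<w) (sym (lo-forward (proj₁ (proj₂ (from-max b))))))
    untwist-noCross _ _ (inj₂ (inj₁ (refl , a))) (inj₁ (refl , refl)) =
      same-lo⇒¬cross _ _ (trans (lo-forward (proj₁ (proj₂ (from-max a)))) (sym (lo-forward v<w)))
    untwist-noCross _ _ (inj₂ (inj₁ (refl , a))) (inj₂ (inj₁ (refl , b))) =
      same-lo⇒¬cross _ _ (trans (lo-forward (proj₁ (proj₂ (from-max a))))
                                (sym (lo-forward (proj₁ (proj₂ (from-max b))))))
    untwist-noCross _ _ (inj₁ (refl , refl)) (inj₂ (inj₂ (b , _))) = min-max¬cross-old b
    untwist-noCross x y (inj₂ (inj₂ (a , _))) (inj₁ (refl , refl)) c =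
      min-max¬cross-old a (cross-sym x y c)
    untwist-noCross _ _ (inj₂ (inj₁ (refl , a))) (inj₂ (inj₂ (b , p≢w))) = untwisted¬cross-old a b p≢w
    untwist-noCross x y (inj₂ (inj₂ (a , x≢w))) (inj₂ (inj₁ (refl , b))) c =
      untwisted¬cross-old b a x≢w (cross-sym x y c)
    untwist-noCross _ _ (inj₂ (inj₂ (a , _))) (inj₂ (inj₂ (b , _))) = noCross _ _ a b

    untwist-fwdNest : ∀ a b → untwist a → untwist b → Forward a → Forward b → NestEachOther a b
    untwist-fwdNest _ (p , q) (inj₁ (refl , refl)) b _ _ with untwist-onV p q b
    ... | Vp , Vq , _ = inj₁ (min-max-nests Vp Vq)
    untwist-fwdNest (x , y) _ a (inj₁ (refl , refl)) _ _ with untwist-onV x y a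
    ... | Vx , Vy , _ = inj₂ (min-max-nests Vx Vy)
    untwist-fwdNest (_ , y) (_ , q) (inj₂ (inj₁ (refl , _))) (inj₂ (inj₁ (refl , _))) v<y v<q
      with ≤-total y q
    ... | inj₁ y≤q = inj₂ (≤-reflexive (trans (lo-forward v<q) (sym (lo-forward v<y))) , ⊔-monoʳ-≤ v y≤q)
    ... | inj₂ q≤y = inj₁ (≤-reflexive (trans (lo-forward v<y) (sym (lo-forward v<q))) , ⊔-monoʳ-≤ v q≤y)
    untwist-fwdNest _ _ (inj₂ (inj₁ (refl , a))) (inj₂ (inj₂ (b , p≢w))) _ fb =
      inj₁ (untwisted-nests-old a b p≢w fb)
    untwist-fwdNest _ _ (inj₂ (inj₂ (a , x≢w))) (inj₂ (inj₁ (refl , b))) fa _ =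
      inj₂ (untwisted-nests-old b a x≢w fa)
    untwist-fwdNest _ _ (inj₂ (inj₂ (a , _))) (inj₂ (inj₂ (b , _))) fa fb = fwdNest _ _ a b fa fb

    untwist-bwdNoNest : ∀ a b → untwist a → untwist b → Backward a → Forward b → ¬ Nests a b
    untwist-bwdNoNest _ _ (inj₁ (refl , refl)) _ w<v _ _ = <⇒≱ w<v (<⇒≤ v<w)
    untwist-bwdNoNest _ _ (inj₂ (inj₁ (refl , a))) _ z<v _ _ = <⇒≱ z<v (<⇒≤ (proj₁ (proj₂ (from-max a))))
    untwist-bwdNoNest _ _ (inj₂ (inj₂ (a , _))) (inj₁ (refl , refl)) _ _ (lo≤v , _) =
      ¬lo≤min (tail∈ valid a) (head∈ valid a) lo≤v
    untwist-bwdNoNest _ _ (inj₂ (inj₂ (a , _))) (inj₂ (inj₁ (refl , _))) _ _ (lo≤v , _) =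
      ¬lo≤min (tail∈ valid a) (head∈ valid a) lo≤v
    untwist-bwdNoNest _ _ (inj₂ (inj₂ (a , _))) (inj₂ (inj₂ (b , _))) ba fb = bwdNoNest _ _ a b ba fb

    untwist-head≢min : ∀ {x y} → untwist (x , y) → y ≢ v
    untwist-head≢min (inj₁ (refl , refl)) e = min≢max (sym e)
    untwist-head≢min (inj₂ (inj₁ (refl , b))) = proj₂ (proj₁ (from-max b))
    untwist-head≢min (inj₂ (inj₂ (b , _))) = proj₂ (head∈ valid b)

    untwist-headTail : ∀ a b → untwist a → untwist b → head a ≢ tail b
    untwist-headTail _ _ a (inj₁ (refl , refl)) = untwist-head≢min a
    untwist-headTail _ _ a (inj₂ (inj₁ (refl , _))) = untwist-head≢min a
    untwist-headTail _ _ (inj₁ (refl , refl)) (inj₂ (inj₂ (_ , p≢w))) eq = p≢w (sym eq)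
    untwist-headTail _ _ (inj₂ (inj₁ (refl , a))) (inj₂ (inj₂ (b , _))) refl = no-path₂ valid a b
    untwist-headTail _ _ (inj₂ (inj₂ (a , _))) (inj₂ (inj₂ (b , _))) eq = headTail _ _ a b eq

    untwist-valid : Valid V untwist
    untwist-valid = record { onV = untwist-onV ; noCross = untwist-noCross ; fwdNest = untwist-fwdNest
                           ; bwdNoNest = untwist-bwdNoNest ; headTail = untwist-headTail }

    tw-untwist⊆ : tw V v w untwist ⊆ B
    tw-untwist⊆ (inj₁ (inj₁ (refl , _) , (_ , v≢v) , _)) = ⊥-elim (v≢v refl)
    tw-untwist⊆ (inj₁ (inj₂ (inj₁ (refl , _)) , (_ , v≢v) , _)) = ⊥-elim (v≢v refl)
    tw-untwist⊆ (inj₁ (inj₂ (inj₂ (b , _)) , _)) = b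
    tw-untwist⊆ (inj₂ (refl , y≢w , inj₁ (_ , y≡w))) = ⊥-elim (y≢w y≡w)
    tw-untwist⊆ (inj₂ (refl , _ , inj₂ (inj₁ (_ , b)))) = b
    tw-untwist⊆ (inj₂ (refl , _ , inj₂ (inj₂ (b , _)))) = ⊥-elim (proj₂ (tail∈ valid b) refl)

    tw-untwist⊇ : B ⊆ tw V v w untwist
    tw-untwist⊇ {x , y} b with x ≟ w
    ... | yes refl = inj₂ (refl , (λ e → tail≢head valid b (sym e)) , inj₂ (inj₁ (refl , b)))
    ... | no x≢w = inj₁ (inj₂ (inj₂ (b , x≢w)) , tail∈ valid b , head∈ valid b)

lemma8p5 : (L : List ℕ) → All (0 <_) L → (v w : ℕ) →
    v ∈ L → w ∈ L → (∀ x → x ∈ L → v ≤ x × x ≤ w) → v < w →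
    let V : NodeSet
        V = λ x → x ∈ L
    in ((A : Digraph) → Valid V A → A (v , w) → Valid (V minus v) (tw V v w A))
       × ((A B : Digraph) → Valid V A → A (v , w) → Valid V B → B (v , w) →
            tw V v w A ≐ tw V v w B → A ≐ B)
       × ((B : Digraph) → Valid (V minus v) B →
            Σ Digraph (λ A → Valid V A × A (v , w) × tw V v w A ≐ B))
lemma8p5 L _ v w v∈L w∈L bounded v<w =
    (λ A VA _ → Twist.tw-valid A VA)
  , (λ A B VA vw∈A VB vw∈B (A⊆B , B⊆A) →
       tw-reflects-⊆ VA vw∈A VB vw∈B A⊆B , tw-reflects-⊆ VB vw∈B VA vw∈A B⊆A)
  , (λ B VB → untwist B VB , untwist-valid B VB , inj₁ (refl , refl)
            , tw-untwist⊆ B VB , tw-untwist⊇ B VB)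
  where
    open Twisting (λ x → x ∈ L) v∈L w∈L bounded v<w
    open Untwist using (untwist; untwist-valid; tw-untwist⊆; tw-untwist⊇)
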